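{- Let $H$ be a Kekul\'ean hexagonal system and $n\ge 0$ an integer. The map $f$ from the set of Clar covers of $H$ with exactly $n$ hexagons to the set of induced subgraphs of $R(H)$ isomorphic to $Q_n$ is injective.
   Context: A hexagonal system is a 2-connected finite plane graph in which every interior face is a regular hexagon of side length one; its hexagons are the boundaries of its interior faces. $H$ is Kekul\'ean if it has a perfect matching. A Clar cover of $H$ is a spanning subgraph of $H$ each of whose connected components is either a hexagon of $H$ or a single edge. The resonance graph $R(H)$ has the perfect matchings of $H$ as vertices, two perfect matchings $M,M'$ being adjacent iff $M\oplus M'$ is the edge set of a hexagon of $H$. A cycle is $M$-alternating if its edges alternately belong and do not belong to $M$. For a Clar cover $C$, $f(C)$ is the subgraph of $R(H)$ induced by all perfect matchings $M$ of $H$ such that every hexagon of $C$ is $M$-alternating and every single-edge component of $C$ belongs to $M$; for a Clar cover with $n$ hexagons this is an induced subgraph isomorphic to the $n$-cube $Q_n$. -}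

module Defs where

open import Data.Integer using (ℤ; +_; _+_; _*_; ∣_∣)
open import Data.Nat using (ℕ; _<_)
open import Data.Bool using (Bool; true; false; not)
open import Data.Product using (Σ; ∃; _×_; _,_; proj₁; proj₂)
open import Data.Sum using (_⊎_)
open import Data.List using (List; []; _∷_; length)
open import Data.List.Membership.Propositional using (_∈_; _∉_)
open import Data.List.Relation.Unary.Any using (Any)
open import Data.List.Relation.Unary.All using (All)
open import Data.List.Relation.Unary.Unique.Propositional using (Unique)
open import Relation.Binary.PropositionalEquality using (_≡_; _≢_)
open import Relation.Nullary using (¬_)

-- The hexagonal (honeycomb) lattice in "brick-wall" coordinates.  Horizontal edges join (x,y) and
-- (x+1,y); vertical edges join (x,y) and (x,y+1) exactly when x+y is even.
-- This is a plane graph isomorphic (as a plane graph) to the regular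
-- hexagonal tiling of side length one.

Vertex : Set
Vertex = ℤ × ℤ

Cell : Set
Cell = ℤ × ℤ

data Edge : Set where
  hor : ℤ → ℤ → Edge
  ver : ℤ → ℤ → Edge

end₁ : Edge → Vertex
end₁ (hor x y) = x , y
end₁ (ver a b) = (+ 2 * a + b) , b

end₂ : Edge → Vertex
end₂ (hor x y) = (x + + 1) , y
end₂ (ver a b) = (+ 2 * a + b) , (b + + 1)

Incident : Vertex → Edge → Set
Incident v e = (v ≡ end₁ e) ⊎ (v ≡ end₂ e)

corners : Cell → List Vertex
corners (a , b) =
  let x = + 2 * a + b in
  (x , b) ∷ (x + + 1 , b) ∷ (x + + 2 , b) ∷
  (x + + 2 , b + + 1) ∷ (x + + 1 , b + + 1) ∷ (x , b + + 1) ∷ []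

-- The six edges of a cell, in cyclic order around the hexagon.
e0 e1 e2 e3 e4 e5 : Cell → Edge
e0 (a , b) = hor (+ 2 * a + b) b
e1 (a , b) = hor (+ 2 * a + b + + 1) b
e2 (a , b) = ver (a + + 1) b
e3 (a , b) = hor (+ 2 * a + b + + 1) (b + + 1)
e4 (a , b) = hor (+ 2 * a + b) (b + + 1)
e5 (a , b) = ver a b

cellEdges : Cell → List Edge
cellEdges c = e0 c ∷ e1 c ∷ e2 c ∷ e3 c ∷ e4 c ∷ e5 c ∷ []

-- The graph spanned by a finite list S of cells: union of their boundaries.

VG : List Cell → Vertex → Set
VG S v = Any (λ c → v ∈ corners c) S

EG : List Cell → Edge → Set
EG S e = Any (λ c → e ∈ cellEdges c) S

data PathIn (S : List Cell) (P : Vertex → Set) : Vertex → Vertex → Set where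
  here : ∀ {u} → VG S u → P u → PathIn S P u u
  step : ∀ {u w} (e : Edge) → EG S e →
         ((u ≡ end₁ e × w ≡ end₂ e) ⊎ (u ≡ end₂ e × w ≡ end₁ e)) →
         P u → ∀ {v} → PathIn S P w v → PathIn S P u v

Connected : List Cell → Set
Connected S = ∀ u v → VG S u → VG S v → PathIn S (λ _ → Data.Unit.⊤) u v
  where import Data.Unit

TwoConnected : List Cell → Set
TwoConnected S =
  (Σ Vertex λ u → Σ Vertex λ v → Σ Vertex λ w →
     VG S u × VG S v × VG S w × u ≢ v × v ≢ w × u ≢ w)
  × Connected S
  × (∀ w u v → VG S w → VG S u → VG S v → u ≢ w → v ≢ w →
       PathIn S (λ z → z ≢ w) u v)

-- Faces of the plane graph: two lattice cells lie in the same face iff they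
-- can be joined by a sequence of cells, consecutive ones sharing a lattice
-- edge that is NOT an edge of the graph.
data FaceReach (S : List Cell) : Cell → Cell → Set where
  refl' : ∀ {c} → FaceReach S c c
  step  : ∀ {c d d'} → FaceReach S c d → (e : Edge) →
          e ∈ cellEdges d → e ∈ cellEdges d' → d ≢ d' → ¬ EG S e →
          FaceReach S c d'

-- Every lattice cell not in S lies in the unbounded (exterior) face.
-- Together with the cells of S each being a face of the graph, this says
-- exactly that the interior faces of the graph are the hexagons of S.
NoHoles : List Cell → Set
NoHoles S = ∀ c → c ∉ S → ∀ (N : ℕ) →
  Σ Cell λ c' → FaceReach S c c' × N < ∣ proj₁ c' ∣ Data.Nat.+ ∣ proj₂ c' ∣
  where import Data.Nat

HexagonalSystem : List Cell → Set
HexagonalSystem S = Unique S × TwoConnected S × NoHoles S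

ExactlyOne : {A : Set} → (A → Set) → Set
ExactlyOne {A} P = Σ A λ x → P x × (∀ y → P y → y ≡ x)

EdgeSet : Set
EdgeSet = Edge → Bool

IsPerfectMatching : List Cell → EdgeSet → Set
IsPerfectMatching S M =
  (∀ e → M e ≡ true → EG S e) ×
  (∀ v → VG S v → ExactlyOne (λ e → M e ≡ true × Incident v e))

Kekulean : List Cell → Set
Kekulean S = Σ EdgeSet λ M → IsPerfectMatching S M

Alternating : EdgeSet → Cell → Set
Alternating M h =
  M (e0 h) ≡ not (M (e1 h)) × M (e1 h) ≡ not (M (e2 h)) ×
  M (e2 h) ≡ not (M (e3 h)) × M (e3 h) ≡ not (M (e4 h)) ×
  M (e4 h) ≡ not (M (e5 h)) × M (e5 h) ≡ not (M (e0 h))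

data Component : Set where
  hexC  : Cell → Component
  edgeC : Edge → Component

OnComponent : Vertex → Component → Set
OnComponent v (hexC h) = v ∈ corners h
OnComponent v (edgeC e) = Incident v e

InCover : List Cell → EdgeSet → Component → Set
InCover K E (hexC h) = h ∈ K
InCover K E (edgeC e) = E e ≡ true

IsClarCover : List Cell → List Cell → EdgeSet → Set
IsClarCover S K E =
  Unique K × All (_∈ S) K × (∀ e → E e ≡ true → EG S e) ×
  (∀ v → VG S v → ExactlyOne (λ comp → InCover K E comp × OnComponent v comp))

-- Membership of a perfect matching M in the vertex set of f(C), C = (K , E).
InF : List Cell → List Cell → EdgeSet → EdgeSet → Set
InF S K E M =
  IsPerfectMatching S M × All (Alternating M) K × (∀ e → E e ≡ true → M e ≡ true)

-- Two induced subgraphs of R(H) are equal iff they have the same vertex set.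
SameF : List Cell → List Cell → EdgeSet → List Cell → EdgeSet → Set
SameF S K E K' E' = ∀ M → IsPerfectMatching S M →
  (InF S K E M → InF S K' E' M) × (InF S K' E' M → InF S K E M)

SameClar : List Cell → EdgeSet → List Cell → EdgeSet → Set
SameClar K E K' E' =
  (∀ h → (h ∈ K → h ∈ K') × (h ∈ K' → h ∈ K)) × (∀ e → E e ≡ E' e)

module Submission where

open import Defs
open import Data.Nat using (ℕ)
open import Data.List using (List; length; []; _∷_)
open import Relation.Binary.PropositionalEquality using (_≡_)

import Data.Nat as ℕ
open import Data.Bool using (Bool; true; false; not; _∨_; if_then_else_)
open import Data.Bool.Properties using (not-involutive)
import Data.Bool.Properties as Bool
open import Data.Empty using (⊥-elim)
open import Data.Integer using (ℤ; +_; _+_; _*_)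
import Data.Integer as ℤ
open import Data.Integer.Properties using (+-assoc; +-identityʳ; +-injective; +-0-abelianGroup)
open import Data.Integer.Tactic.RingSolver using (solve-∀)
open import Algebra.Properties.AbelianGroup +-0-abelianGroup using (∙-cancelˡ)
open import Data.List.Membership.Propositional using (_∈_; find; lose)
open import Data.List.Relation.Unary.All using (All; tabulate)
import Data.List.Relation.Unary.All as All
open import Data.List.Relation.Unary.Any using (here; there; any?)
import Data.List.Relation.Unary.Any as Any
open import Data.Product using (Σ; _×_; _,_; proj₁; proj₂)
open import Data.Product.Properties using (≡-dec)
open import Data.Sum using (_⊎_; inj₁; inj₂)
open import Relation.Binary.Definitions using (DecidableEquality)
open import Relation.Binary.PropositionalEquality
  using (_≢_; refl; sym; trans; cong; cong₂; subst; module ≡-Reasoning)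
open import Relation.Nullary using (Dec; yes; no)
open import Relation.Nullary.Decidable using (isYes; map′; _×-dec_)

-- Each Clar cover C = (K, E) has two perfect matchings in f(C): E together with, for every
-- hexagon of K, the three sides of one fixed parity (the same parity for all hexagons).  These
-- two matchings already pin C down.  If f(C′) ⊆ f(C), an edge e of E lies in both matchings
-- of C′, so the component of C′ at an endpoint of e cannot be a hexagon (whose two matchings
-- differ there) and must be e itself: E ⊆ E′.  Given E′ ⊆ E and f(C) ⊆ f(C′), a corner of a
-- hexagon h of K lies in a hexagon h′ of C′; h′ alternates in both matchings of C, and at
-- every corner the two hexagons share, the matched side of h is the matched side of h′.
-- Walking around h this puts two opposite sides of h into h′, so h′ = h.

≡true-ext : ∀ {x y} → (x ≡ true → y ≡ true) → (y ≡ true → x ≡ true) → x ≡ y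
≡true-ext {true}  {true}  _ _ = refl
≡true-ext {true}  {false} x⇒y _ = sym (x⇒y refl)
≡true-ext {false} {true}  _ y⇒x = y⇒x refl
≡true-ext {false} {false} _ _ = refl

-- Side indexes both the sides e0 … e5 of a cell and its corners, in the order of corners;
-- sideEnd k b is the corner at endpoint b (true for end₁) of side k.
data Side : Set where
  k0 k1 k2 k3 k4 k5 : Side

side : Side → Cell → Edge
side k0 = e0
side k1 = e1
side k2 = e2
side k3 = e3
side k4 = e4
side k5 = e5

corner : Side → Cell → Vertex
corner k0 (a , b) = + 2 * a + b , b
corner k1 (a , b) = + 2 * a + b + + 1 , b
corner k2 (a , b) = + 2 * a + b + + 2 , b
corner k3 (a , b) = + 2 * a + b + + 2 , b + + 1
corner k4 (a , b) = + 2 * a + b + + 1 , b + + 1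
corner k5 (a , b) = + 2 * a + b , b + + 1

parity : Side → Bool
parity k0 = true
parity k1 = false
parity k2 = true
parity k3 = false
parity k4 = true
parity k5 = false

endpoint : Bool → Edge → Vertex
endpoint true  = end₁
endpoint false = end₂

sideEnd : Side → Bool → Side
sideEnd k0 true = k0
sideEnd k0 false = k1
sideEnd k1 true = k1
sideEnd k1 false = k2
sideEnd k2 true = k2
sideEnd k2 false = k3
sideEnd k3 true = k4
sideEnd k3 false = k3
sideEnd k4 true = k5
sideEnd k4 false = k4
sideEnd k5 true = k0
sideEnd k5 false = k5

-- The side of parity q at corner c: every corner meets one side of each parity.
sideAt : Bool → Side → Side
sideAt true k0 = k0
sideAt true k1 = k0
sideAt true k2 = k2
sideAt true k3 = k2
sideAt true k4 = k4
sideAt true k5 = k4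
sideAt false k0 = k5
sideAt false k1 = k1
sideAt false k2 = k1
sideAt false k3 = k3
sideAt false k4 = k3
sideAt false k5 = k5

sideAt-sideEnd : ∀ k b → sideAt (parity k) (sideEnd k b) ≡ k
sideAt-sideEnd k0 true = refl
sideAt-sideEnd k0 false = refl
sideAt-sideEnd k1 true = refl
sideAt-sideEnd k1 false = refl
sideAt-sideEnd k2 true = refl
sideAt-sideEnd k2 false = refl
sideAt-sideEnd k3 true = refl
sideAt-sideEnd k3 false = refl
sideAt-sideEnd k4 true = refl
sideAt-sideEnd k4 false = refl
sideAt-sideEnd k5 true = refl
sideAt-sideEnd k5 false = refl

parity-sideAt : ∀ q c → parity (sideAt q c) ≡ q
parity-sideAt true k0 = refl
parity-sideAt true k1 = refl
parity-sideAt true k2 = refl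
parity-sideAt true k3 = refl
parity-sideAt true k4 = refl
parity-sideAt true k5 = refl
parity-sideAt false k0 = refl
parity-sideAt false k1 = refl
parity-sideAt false k2 = refl
parity-sideAt false k3 = refl
parity-sideAt false k4 = refl
parity-sideAt false k5 = refl

sideEnd-sideAt : ∀ q c → Σ Bool λ b → sideEnd (sideAt q c) b ≡ c
sideEnd-sideAt true k0 = true , refl
sideEnd-sideAt true k1 = false , refl
sideEnd-sideAt true k2 = true , refl
sideEnd-sideAt true k3 = false , refl
sideEnd-sideAt true k4 = false , refl
sideEnd-sideAt true k5 = true , refl
sideEnd-sideAt false k0 = true , refl
sideEnd-sideAt false k1 = true , refl
sideEnd-sideAt false k2 = false , refl
sideEnd-sideAt false k3 = false , refl
sideEnd-sideAt false k4 = true , refl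
sideEnd-sideAt false k5 = false , refl

2[a+1]+b≡2a+b+2 : ∀ a b → + 2 * (a + + 1) + b ≡ + 2 * a + b + + 2
2[a+1]+b≡2a+b+2 = solve-∀

endpoint-side : ∀ k b h → endpoint b (side k h) ≡ corner (sideEnd k b) h
endpoint-side k0 true (a , b) = refl
endpoint-side k0 false (a , b) = refl
endpoint-side k1 true (a , b) = refl
endpoint-side k1 false (a , b) = cong (_, b) (+-assoc (+ 2 * a + b) (+ 1) (+ 1))
endpoint-side k2 true (a , b) = cong (_, b) (2[a+1]+b≡2a+b+2 a b)
endpoint-side k2 false (a , b) = cong (_, b + + 1) (2[a+1]+b≡2a+b+2 a b)
endpoint-side k3 true (a , b) = refl
endpoint-side k3 false (a , b) = cong (_, b + + 1) (+-assoc (+ 2 * a + b) (+ 1) (+ 1))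
endpoint-side k4 true (a , b) = refl
endpoint-side k4 false (a , b) = refl
endpoint-side k5 true (a , b) = refl
endpoint-side k5 false (a , b) = refl

∈-corners⇒ : ∀ {v} h → v ∈ corners h → Σ Side λ c → v ≡ corner c h
∈-corners⇒ h (here p) = k0 , p
∈-corners⇒ h (there (here p)) = k1 , p
∈-corners⇒ h (there (there (here p))) = k2 , p
∈-corners⇒ h (there (there (there (here p)))) = k3 , p
∈-corners⇒ h (there (there (there (there (here p))))) = k4 , p
∈-corners⇒ h (there (there (there (there (there (here p)))))) = k5 , p

corner-∈ : ∀ c h → corner c h ∈ corners h
corner-∈ k0 h = here refl
corner-∈ k1 h = there (here refl)
corner-∈ k2 h = there (there (here refl))
corner-∈ k3 h = there (there (there (here refl)))
corner-∈ k4 h = there (there (there (there (here refl))))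
corner-∈ k5 h = there (there (there (there (there (here refl)))))

∈-cellEdges⇒ : ∀ {g} h → g ∈ cellEdges h → Σ Side λ k → g ≡ side k h
∈-cellEdges⇒ h (here p) = k0 , p
∈-cellEdges⇒ h (there (here p)) = k1 , p
∈-cellEdges⇒ h (there (there (here p))) = k2 , p
∈-cellEdges⇒ h (there (there (there (here p)))) = k3 , p
∈-cellEdges⇒ h (there (there (there (there (here p))))) = k4 , p
∈-cellEdges⇒ h (there (there (there (there (there (here p)))))) = k5 , p

side-∈ : ∀ k h → side k h ∈ cellEdges h
side-∈ k0 h = here refl
side-∈ k1 h = there (here refl)
side-∈ k2 h = there (there (here refl))
side-∈ k3 h = there (there (there (here refl)))
side-∈ k4 h = there (there (there (there (here refl))))
side-∈ k5 h = there (there (there (there (there (here refl)))))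

incident-side⇒ : ∀ {v} k h → Incident v (side k h) → Σ Bool λ b → v ≡ corner (sideEnd k b) h
incident-side⇒ k h (inj₁ p) = true , trans p (endpoint-side k true h)
incident-side⇒ k h (inj₂ p) = false , trans p (endpoint-side k false h)

sideEnd-incident : ∀ k b h → Incident (corner (sideEnd k b) h) (side k h)
sideEnd-incident k true h = inj₁ (sym (endpoint-side k true h))
sideEnd-incident k false h = inj₂ (sym (endpoint-side k false h))

sideAt-incident : ∀ q c h → Incident (corner c h) (side (sideAt q c) h)
sideAt-incident q c h with sideEnd-sideAt q c
... | b , p = subst (λ c′ → Incident (corner c′ h) (side (sideAt q c) h)) p
                    (sideEnd-incident (sideAt q c) b h)

incident-∈cellEdges⇒∈corners : ∀ {v g} h → g ∈ cellEdges h → Incident v g → v ∈ corners h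
incident-∈cellEdges⇒∈corners h g∈h vg with ∈-cellEdges⇒ h g∈h
... | k , refl with incident-side⇒ k h vg
...   | b , refl = corner-∈ (sideEnd k b) h

incident-EG⇒VG : ∀ {S v g} → EG S g → Incident v g → VG S v
incident-EG⇒VG g∈S vg = Any.map (λ {h} g∈h → incident-∈cellEdges⇒∈corners h g∈h vg) g∈S

-- A corner is the cell's base point shifted by a natural offset, which determines it.
offset : Side → ℕ × ℕ
offset k0 = 0 , 0
offset k1 = 1 , 0
offset k2 = 2 , 0
offset k3 = 2 , 1
offset k4 = 1 , 1
offset k5 = 0 , 1

sideOfOffset : ℕ × ℕ → Side
sideOfOffset (0 , 0) = k0
sideOfOffset (1 , 0) = k1
sideOfOffset (2 , 0) = k2
sideOfOffset (2 , 1) = k3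
sideOfOffset (1 , 1) = k4
sideOfOffset _ = k5

sideOfOffset-offset : ∀ c → sideOfOffset (offset c) ≡ c
sideOfOffset-offset k0 = refl
sideOfOffset-offset k1 = refl
sideOfOffset-offset k2 = refl
sideOfOffset-offset k3 = refl
sideOfOffset-offset k4 = refl
sideOfOffset-offset k5 = refl

shift : Cell → ℕ × ℕ → Vertex
shift (a , b) (i , j) = + 2 * a + b + + i , b + + j

corner≡shift : ∀ c h → corner c h ≡ shift h (offset c)
corner≡shift k0 (a , b) = cong₂ _,_ (sym (+-identityʳ (+ 2 * a + b))) (sym (+-identityʳ b))
corner≡shift k1 (a , b) = cong (+ 2 * a + b + + 1 ,_) (sym (+-identityʳ b))
corner≡shift k2 (a , b) = cong (+ 2 * a + b + + 2 ,_) (sym (+-identityʳ b))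
corner≡shift k3 (a , b) = refl
corner≡shift k4 (a , b) = refl
corner≡shift k5 (a , b) = cong (_, b + + 1) (sym (+-identityʳ (+ 2 * a + b)))

shift-injective : ∀ h {o o′} → shift h o ≡ shift h o′ → o ≡ o′
shift-injective (a , b) eq =
  cong₂ _,_ (+-injective (∙-cancelˡ (+ 2 * a + b) _ _ (cong proj₁ eq)))
            (+-injective (∙-cancelˡ b _ _ (cong proj₂ eq)))

corner-injective : ∀ {h} c c′ → corner c h ≡ corner c′ h → c ≡ c′
corner-injective {h} c c′ eq = begin
  c                          ≡⟨ sym (sideOfOffset-offset c) ⟩
  sideOfOffset (offset c)    ≡⟨ cong sideOfOffset (shift-injective h offsets) ⟩
  sideOfOffset (offset c′)   ≡⟨ sideOfOffset-offset c′ ⟩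
  c′                         ∎
  where
  open ≡-Reasoning
  offsets : shift h (offset c) ≡ shift h (offset c′)
  offsets = trans (sym (corner≡shift c h)) (trans eq (corner≡shift c′ h))

sideOfEnds : Side → Side → Side
sideOfEnds k0 k1 = k0
sideOfEnds k1 k2 = k1
sideOfEnds k2 k3 = k2
sideOfEnds k4 k3 = k3
sideOfEnds k5 k4 = k4
sideOfEnds _ _ = k5

sideOfEnds-sideEnd : ∀ k → sideOfEnds (sideEnd k true) (sideEnd k false) ≡ k
sideOfEnds-sideEnd k0 = refl
sideOfEnds-sideEnd k1 = refl
sideOfEnds-sideEnd k2 = refl
sideOfEnds-sideEnd k3 = refl
sideOfEnds-sideEnd k4 = refl
sideOfEnds-sideEnd k5 = refl

side-injective : ∀ {h} k k′ → side k h ≡ side k′ h → k ≡ k′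
side-injective {h} k k′ eq = begin
  k                                               ≡⟨ sym (sideOfEnds-sideEnd k) ⟩
  sideOfEnds (sideEnd k true) (sideEnd k false)   ≡⟨ cong₂ sideOfEnds (ends true) (ends false) ⟩
  sideOfEnds (sideEnd k′ true) (sideEnd k′ false) ≡⟨ sideOfEnds-sideEnd k′ ⟩
  k′                                              ∎
  where
  open ≡-Reasoning
  ends : ∀ b → sideEnd k b ≡ sideEnd k′ b
  ends b = corner-injective _ _
    (trans (sym (endpoint-side k b h)) (trans (cong (endpoint b) eq) (endpoint-side k′ b h)))

ver-injective : ∀ {a b a′ b′} → ver a b ≡ ver a′ b′ → a ≡ a′ × b ≡ b′
ver-injective refl = refl , refl

a+1+n≢a : ∀ a n → a + + 1 + + n ≢ a
a+1+n≢a a n eq with ∙-cancelˡ a (+ (1 ℕ.+ n)) (+ 0)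
                      (trans (sym (+-assoc a (+ 1) (+ n))) (trans eq (sym (+-identityʳ a))))
... | ()

vertical-sides-determine-cell : ∀ h h′ → side k2 h ∈ cellEdges h′ → side k5 h ∈ cellEdges h′ → h ≡ h′
vertical-sides-determine-cell (a , b) (a′ , b′) k2∈ k5∈ with ∈-cellEdges⇒ (a′ , b′) k2∈ | ∈-cellEdges⇒ (a′ , b′) k5∈
... | k0 , () | _
... | k1 , () | _
... | k3 , () | _
... | k4 , () | _
... | _ | k0 , ()
... | _ | k1 , ()
... | _ | k3 , ()
... | _ | k4 , ()
... | _ | k5 , p = cong₂ _,_ (proj₁ (ver-injective p)) (proj₂ (ver-injective p))
... | k2 , p | k2 , q = ⊥-elim (a+1+n≢a (a′ + + 1) 0
  (trans (+-identityʳ _) (trans (cong (_+ + 1) (sym (proj₁ (ver-injective q)))) (proj₁ (ver-injective p)))))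
... | k5 , p | k2 , q = ⊥-elim (a+1+n≢a a′ 1
  (trans (cong (_+ + 1) (sym (proj₁ (ver-injective q)))) (proj₁ (ver-injective p))))

-- Alternating hexagons

-- An alternating hexagon contains exactly the sides of one parity; phase q selects parity q.
phase : Bool → Side → Bool
phase q k = if parity k then q else not q

phase≡true⇒ : ∀ q k → phase q k ≡ true → parity k ≡ q
phase≡true⇒ q k with parity k
... | true = sym
... | false = λ p → trans (cong not (sym p)) (not-involutive q)

phase≡true⇐ : ∀ q k → parity k ≡ q → phase q k ≡ true
phase≡true⇐ .(parity k) k refl with parity k
... | true = refl
... | false = refl

phase-alternating : ∀ M h q → (∀ k → M (side k h) ≡ phase q k) → Alternating M h
phase-alternating M h q p
  rewrite p k0 | p k1 | p k2 | p k3 | p k4 | p k5 | not-involutive q =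
  refl , refl , refl , refl , refl , refl

alternating-phase : ∀ M h → Alternating M h → ∀ k → M (side k h) ≡ phase (M (e0 h)) k
alternating-phase M h (a01 , a12 , a23 , a34 , a45 , _) = at
  where
  q = M (e0 h)
  flip : ∀ {x y} → x ≡ not y → y ≡ not x
  flip {x} {y} p = trans (sym (not-involutive y)) (cong not (sym p))
  m1 : M (e1 h) ≡ not q
  m1 = flip a01
  m2 : M (e2 h) ≡ q
  m2 = trans (flip a12) (trans (cong not m1) (not-involutive q))
  m3 : M (e3 h) ≡ not q
  m3 = trans (flip a23) (cong not m2)
  m4 : M (e4 h) ≡ q
  m4 = trans (flip a34) (trans (cong not m3) (not-involutive q))
  at : ∀ k → M (side k h) ≡ phase q k
  at k0 = refl
  at k1 = m1
  at k2 = m2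
  at k3 = m3
  at k4 = m4
  at k5 = trans (flip a45) (cong not m4)

alternating-corner : ∀ M h → Alternating M h → ∀ {v} → v ∈ corners h →
  Σ Side λ k → M (side k h) ≡ true × Incident v (side k h)
alternating-corner M h alt v∈h with ∈-corners⇒ h v∈h
... | c , refl = sideAt q c , M-side , sideAt-incident q c h
  where
  q = M (e0 h)
  M-side : M (side (sideAt q c) h) ≡ true
  M-side = trans (alternating-phase M h alt (sideAt q c))
                 (phase≡true⇐ q (sideAt q c) (parity-sideAt q c))

-- The two perfect matchings in f(C)

edgeCode : Edge → Bool × ℤ × ℤ
edgeCode (hor x y) = true , x , y
edgeCode (ver a b) = false , a , b

edgeCode-injective : ∀ {g g′} → edgeCode g ≡ edgeCode g′ → g ≡ g′
edgeCode-injective {hor _ _} {hor _ _} refl = refl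
edgeCode-injective {ver _ _} {ver _ _} refl = refl

_≟ₑ_ : DecidableEquality Edge
g ≟ₑ g′ = map′ edgeCode-injective (cong edgeCode)
  (≡-dec Bool._≟_ (≡-dec ℤ._≟_ ℤ._≟_) (edgeCode g) (edgeCode g′))

PhaseSide : Bool → Edge → Cell → Set
PhaseSide q g h = Σ Side λ k → parity k ≡ q × g ≡ side k h

sides : List Side
sides = k0 ∷ k1 ∷ k2 ∷ k3 ∷ k4 ∷ k5 ∷ []

∈-sides : ∀ k → k ∈ sides
∈-sides k0 = here refl
∈-sides k1 = there (here refl)
∈-sides k2 = there (there (here refl))
∈-sides k3 = there (there (there (here refl)))
∈-sides k4 = there (there (there (there (here refl))))
∈-sides k5 = there (there (there (there (there (here refl)))))

phaseSide? : ∀ q g h → Dec (PhaseSide q g h)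
phaseSide? q g h =
  map′ (λ a → let k , _ , p = find a in k , p) (λ (k , p) → lose (∈-sides k) p)
       (any? (λ k → (parity k Bool.≟ q) ×-dec (g ≟ₑ side k h)) sides)

clarMatching : List Cell → EdgeSet → Bool → EdgeSet
clarMatching K E q g = E g ∨ isYes (any? (phaseSide? q g) K)

clarMatching-edge : ∀ K E q g → E g ≡ true → clarMatching K E q g ≡ true
clarMatching-edge K E q g Eg rewrite Eg = refl

clarMatching-side : ∀ K E q {h} k → h ∈ K → parity k ≡ q → clarMatching K E q (side k h) ≡ true
clarMatching-side K E q {h} k h∈K pk with E (side k h) | any? (phaseSide? q (side k h)) K
... | true  | _     = refl
... | false | yes _ = refl
... | false | no ¬a = ⊥-elim (¬a (lose h∈K (k , pk , refl)))

clarMatching≡true⇒ : ∀ K E q g → clarMatching K E q g ≡ true →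
  E g ≡ true ⊎ Σ Cell λ h → h ∈ K × PhaseSide q g h
clarMatching≡true⇒ K E q g _ with E g | any? (phaseSide? q g) K
... | true  | _     = inj₁ refl
... | false | yes a = inj₂ (find a)
clarMatching≡true⇒ K E q g () | false | no _

module ClarCover {S K : List Cell} {E : EdgeSet} (C : IsClarCover S K E) where

  hexagons⊆S : All (_∈ S) K
  hexagons⊆S = proj₁ (proj₂ C)

  edges⊆S : ∀ e → E e ≡ true → EG S e
  edges⊆S = proj₁ (proj₂ (proj₂ C))

  cover : ∀ v → VG S v → ExactlyOne (λ c → InCover K E c × OnComponent v c)
  cover = proj₂ (proj₂ (proj₂ C))

  component-unique : ∀ {v} → VG S v → ∀ {c c′} →
    InCover K E c → OnComponent v c → InCover K E c′ → OnComponent v c′ → c ≡ c′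
  component-unique {v} v∈S {c} {c′} inC onC inC′ onC′ with cover v v∈S
  ... | _ , _ , unique = trans (unique c (inC , onC)) (sym (unique c′ (inC′ , onC′)))

  corner∈S : ∀ {h v} → h ∈ K → v ∈ corners h → VG S v
  corner∈S h∈K v∈h = lose (All.lookup hexagons⊆S h∈K) v∈h

  M : Bool → EdgeSet
  M = clarMatching K E

  matched-at-edge : ∀ q {v e} → E e ≡ true → Incident v e →
    ∀ {g} → M q g ≡ true → Incident v g → g ≡ e
  matched-at-edge q {v} {e} Ee ve {g} Mg vg with clarMatching≡true⇒ K E q g Mg
  ... | inj₁ Eg with component-unique (incident-EG⇒VG (edges⊆S e Ee) ve) {edgeC g} Eg vg Ee ve
  ...   | refl = refl
  matched-at-edge q {v} {e} Ee ve {g} Mg vg | inj₂ (h , h∈K , k , _ , refl)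
    with component-unique (incident-EG⇒VG (edges⊆S e Ee) ve) {hexC h}
           h∈K (incident-∈cellEdges⇒∈corners h (side-∈ k h) vg) Ee ve
  ... | ()

  matched-at-corner : ∀ q c {h} → h ∈ K →
    ∀ {g} → M q g ≡ true → Incident (corner c h) g → g ≡ side (sideAt q c) h
  matched-at-corner q c {h} h∈K {g} Mg vg with clarMatching≡true⇒ K E q g Mg
  ... | inj₁ Eg with component-unique (corner∈S h∈K (corner-∈ c h)) {edgeC g} Eg vg h∈K (corner-∈ c h)
  ...   | ()
  matched-at-corner q c {h} h∈K {g} Mg vg | inj₂ (h′ , h′∈K , k , pk , refl)
    with component-unique (corner∈S h∈K (corner-∈ c h)) {hexC h′}
           h′∈K (incident-∈cellEdges⇒∈corners h′ (side-∈ k h′) vg) h∈K (corner-∈ c h)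
  ... | refl with incident-side⇒ k h vg
  ...   | b , c≡end = cong (λ k′ → side k′ h) (begin
    k                               ≡⟨ sym (sideAt-sideEnd k b) ⟩
    sideAt (parity k) (sideEnd k b) ≡⟨ cong₂ sideAt pk (corner-injective _ _ (sym c≡end)) ⟩
    sideAt q c                      ∎)
    where open ≡-Reasoning

  perfect : ∀ q → IsPerfectMatching S (M q)
  perfect q = ⊆S , λ v v∈S → matched (cover v v∈S)
    where
    ⊆S : ∀ g → M q g ≡ true → EG S g
    ⊆S g Mg with clarMatching≡true⇒ K E q g Mg
    ... | inj₁ Eg = edges⊆S g Eg
    ... | inj₂ (h , h∈K , k , _ , refl) = lose (All.lookup hexagons⊆S h∈K) (side-∈ k h)
    matched : ∀ {v} → ExactlyOne (λ c → InCover K E c × OnComponent v c) →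
              ExactlyOne (λ g → M q g ≡ true × Incident v g)
    matched (edgeC e , (Ee , ve) , _) =
      e , (clarMatching-edge K E q e Ee , ve) , λ g (Mg , vg) → matched-at-edge q Ee ve Mg vg
    matched (hexC h , (h∈K , v∈h) , _) with ∈-corners⇒ h v∈h
    ... | c , refl =
      side (sideAt q c) h ,
      (clarMatching-side K E q (sideAt q c) h∈K (parity-sideAt q c) , sideAt-incident q c h) ,
      λ g (Mg , vg) → matched-at-corner q c h∈K Mg vg

  side-parity : ∀ q {h} k → h ∈ K → M q (side k h) ≡ true → parity k ≡ q
  side-parity q {h} k h∈K Mk = begin
    parity k                           ≡⟨ cong parity (side-injective k _ on-k) ⟩
    parity (sideAt q (sideEnd k true)) ≡⟨ parity-sideAt q (sideEnd k true) ⟩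
    q                                  ∎
    where
    open ≡-Reasoning
    on-k : side k h ≡ side (sideAt q (sideEnd k true)) h
    on-k = matched-at-corner q (sideEnd k true) h∈K Mk (sideEnd-incident k true h)

  in-phase : ∀ q {h} → h ∈ K → ∀ k → M q (side k h) ≡ phase q k
  in-phase q h∈K k = ≡true-ext
    (λ Mk → phase≡true⇐ q k (side-parity q k h∈K Mk))
    (λ φk → clarMatching-side K E q k h∈K (phase≡true⇒ q k φk))

  ∈f : ∀ q → InF S K E (M q)
  ∈f q = perfect q ,
         tabulate (λ {h} h∈K → phase-alternating (M q) h q (in-phase q h∈K)) ,
         λ e Ee → clarMatching-edge K E q e Ee

-- Recovering a Clar cover from f(C)

SubF : List Cell → List Cell → EdgeSet → List Cell → EdgeSet → Set
SubF S K E K′ E′ = ∀ M → InF S K E M → InF S K′ E′ M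

edges-⊆ : ∀ {S K E K′ E′} → IsClarCover S K E → IsClarCover S K′ E′ →
  SubF S K′ E′ K E → ∀ e → E e ≡ true → E′ e ≡ true
edges-⊆ {S} {K} {E} {K′} {E′} C C′ f′⊆f e Ee = at-component (C′.cover v v∈S)
  where
  module C = ClarCover C
  module C′ = ClarCover C′
  v = end₁ e
  v∈S : VG S v
  v∈S = incident-EG⇒VG (C.edges⊆S e Ee) (inj₁ refl)
  e∈M′ : ∀ q → C′.M q e ≡ true
  e∈M′ q = proj₂ (proj₂ (f′⊆f _ (C′.∈f q))) e Ee
  at-component : ExactlyOne (λ c → InCover K′ E′ c × OnComponent v c) → E′ e ≡ true
  at-component (edgeC e′ , (E′e′ , ve′) , _) =
    subst (λ g → E′ g ≡ true) (sym (C′.matched-at-edge true E′e′ ve′ (e∈M′ true) (inj₁ refl))) E′e′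
  at-component (hexC h′ , (h′∈K′ , v∈h′) , _) with ∈-corners⇒ h′ v∈h′
  ... | c , v≡c = ⊥-elim (true≢false (begin
    true                    ≡⟨ sym (parity-sideAt true c) ⟩
    parity (sideAt true c)  ≡⟨ cong parity (side-injective _ _ (trans (sym (e≡ true)) (e≡ false))) ⟩
    parity (sideAt false c) ≡⟨ parity-sideAt false c ⟩
    false                   ∎))
    where
    open ≡-Reasoning
    e≡ : ∀ q → e ≡ side (sideAt q c) h′
    e≡ q = C′.matched-at-corner q c h′∈K′ (e∈M′ q) (subst (λ w → Incident w e) v≡c (inj₁ refl))
    true≢false : true ≢ false
    true≢false ()

hexagons-⊆ : ∀ {S K E K′ E′} → IsClarCover S K E → IsClarCover S K′ E′ →
  SubF S K E K′ E′ → (∀ e → E′ e ≡ true → E e ≡ true) → ∀ h → h ∈ K → h ∈ K′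
hexagons-⊆ {S} {K} {E} {K′} {E′} C C′ f⊆f′ E′⊆E h h∈K = at-component (C′.cover v v∈S)
  where
  module C = ClarCover C
  module C′ = ClarCover C′
  v = corner k0 h
  v∈S : VG S v
  v∈S = C.corner∈S h∈K (corner-∈ k0 h)
  at-component : ExactlyOne (λ c → InCover K′ E′ c × OnComponent v c) → h ∈ K′
  at-component (edgeC e′ , (E′e′ , ve′) , _)
    with C.component-unique v∈S {edgeC e′} (E′⊆E e′ E′e′) ve′ h∈K (corner-∈ k0 h)
  ... | ()
  at-component (hexC h′ , (h′∈K′ , v∈h′) , _) =
    subst (_∈ K′) (sym (vertical-sides-determine-cell h h′ k2∈h′ k5∈h′)) h′∈K′
    where
    shared-corner⇒shared-side : ∀ k b → corner (sideEnd k b) h ∈ corners h′ → side k h ∈ cellEdges h′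
    shared-corner⇒shared-side k b w∈h′
      with alternating-corner (C.M (parity k)) h′
             (All.lookup (proj₁ (proj₂ (f⊆f′ _ (C.∈f (parity k))))) h′∈K′) w∈h′
    ... | j , Mj , wj = subst (_∈ cellEdges h′) j≡k (side-∈ j h′)
      where
      j≡k : side j h′ ≡ side k h
      j≡k = trans (C.matched-at-corner (parity k) (sideEnd k b) h∈K Mj wj)
                  (cong (λ k′ → side k′ h) (sideAt-sideEnd k b))
    other-end : ∀ k b → side k h ∈ cellEdges h′ → corner (sideEnd k b) h ∈ corners h′
    other-end k b k∈h′ = incident-∈cellEdges⇒∈corners h′ k∈h′ (sideEnd-incident k b h)
    k0∈h′ : side k0 h ∈ cellEdges h′
    k0∈h′ = shared-corner⇒shared-side k0 true v∈h′
    k1∈h′ : side k1 h ∈ cellEdges h′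
    k1∈h′ = shared-corner⇒shared-side k1 true (other-end k0 false k0∈h′)
    k2∈h′ : side k2 h ∈ cellEdges h′
    k2∈h′ = shared-corner⇒shared-side k2 true (other-end k1 false k1∈h′)
    k5∈h′ : side k5 h ∈ cellEdges h′
    k5∈h′ = shared-corner⇒shared-side k5 true v∈h′

lemma2 : (S : List Cell) → HexagonalSystem S → Kekulean S → (n : ℕ) →
    (K : List Cell) (E : EdgeSet) → IsClarCover S K E → length K ≡ n →
    (K' : List Cell) (E' : EdgeSet) → IsClarCover S K' E' → length K' ≡ n →
    SameF S K E K' E' → SameClar K E K' E'
lemma2 S _ _ _ K E C _ K′ E′ C′ _ same =
  (λ h → hexagons-⊆ C C′ f⊆f′ E′⊆E h , hexagons-⊆ C′ C f′⊆f E⊆E′ h) ,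
  λ e → ≡true-ext (E⊆E′ e) (E′⊆E e)
  where
  f⊆f′ : SubF S K E K′ E′
  f⊆f′ M M∈f = proj₁ (same M (proj₁ M∈f)) M∈f
  f′⊆f : SubF S K′ E′ K E
  f′⊆f M M∈f′ = proj₂ (same M (proj₁ M∈f′)) M∈f′
  E⊆E′ : ∀ e → E e ≡ true → E′ e ≡ true
  E⊆E′ = edges-⊆ C C′ f′⊆f
  E′⊆E : ∀ e → E′ e ≡ true → E e ≡ true
  E′⊆E = edges-⊆ C′ C f⊆f′
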